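{- Let $k\ge1$ and let $\lambda=(\lambda_1,\ldots,\lambda_r)$ be a nonempty $k$-bounded partition. There is a unique sequence of skew diagrams $D_r,D_{r-1},\ldots,D_1$ such that $D_r$ is the one-row diagram $(\lambda_r)/\emptyset$; for each $i<r$, if $D_{i+1}=\gamma/\rho$ with $\gamma=(\gamma_1,\gamma_2,\ldots)$ and $\rho=(\rho_1,\rho_2,\ldots)$, then $D_i=\bar\gamma/\bar\rho$ with $\bar\gamma=(a+\lambda_i,\gamma_1,\gamma_2,\ldots)$ and $\bar\rho=(a,\rho_1,\rho_2,\ldots)$ for some integer $a$ making $\bar\gamma,\bar\rho$ partitions (i.e. $D_i$ is obtained by attaching a row of length $\lambda_i$ to the bottom of $D_{i+1}$); and each $D_i=\gamma/\rho$ satisfies (1) every cell $s\in\gamma/\rho$ has $h_s(\gamma/\rho)\le k$ and (2) every cell $s\in\rho$ has $h_s(\gamma/\rho)>k$. In particular, $D_1$ is the unique skew diagram $\gamma/\rho$ such that (a) $\gamma$ has $r$ rows and $\gamma_j-\rho_j=\lambda_j$ for $j=1,\ldots,r$, and (b) $\gamma$ is a $(k+1)$-core and $\rho=\rho(\gamma)$.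
   Context: Partitions are identified with Ferrers diagrams in French convention: cells $(i,j)$ with $1\le j\le\lambda_i$, $i$ the row (row 1 at the bottom), $j$ the column. A partition is $k$-bounded if its largest part is at most $k$. For partitions $\rho\subseteq\gamma$ and any lattice square $s=(i,j)\in\gamma$ (possibly in $\rho$), $h_s(\gamma/\rho)$ is the number of cells of $\gamma/\rho$ of the form $(i,j')$ with $j'\ge j$ or $(i',j)$ with $i'>i$; $h_s(\gamma)=h_s(\gamma/\emptyset)$ is the usual hook length. A $(k+1)$-core is a partition with no cell of hook length exactly $k+1$. For a partition $\gamma$, $\rho(\gamma)$ is the set of cells $s$ of $\gamma$ with $h_s(\gamma)>k$ (a partition diagram). -}

module Defs where

open import Data.Nat using (ℕ; zero; suc; _+_; _≤_; _<_; _≥_; _≤ᵇ_; _<ᵇ_)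
open import Data.Bool using (Bool; _∧_)
open import Data.List using (List; []; _∷_; length; upTo; filterᵇ)
open import Data.List.Relation.Unary.All using (All)
open import Data.List.Relation.Unary.Linked using (Linked)
open import Data.Product using (_×_; _,_)
open import Relation.Binary.PropositionalEquality using (_≡_; _≢_)

-- A partition is a list of naturals, head = row 1 (bottom row), weakly decreasing.
-- Row i (0-indexed, i.e. the paper's row i+1) has length (get γ i);
-- rows beyond the list have length 0.
-- The cell (i , j) (0-indexed; paper's (i+1 , j+1)) lies in γ iff j < get γ i.

get : List ℕ → ℕ → ℕ
get []       _       = 0
get (x ∷ xs) zero    = x
get (x ∷ xs) (suc i) = get xs i

-- weakly decreasing list of naturals (zero parts allowed: used to pad ρ)
IsPartition : List ℕ → Set
IsPartition = Linked _≥_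

-- A skew diagram γ/ρ is represented by the pair (γ , ρ), where ρ is padded
-- with zeros to the same length as γ.
Skew : Set
Skew = List ℕ × List ℕ

inSkewᵇ : List ℕ → List ℕ → ℕ → ℕ → Bool
inSkewᵇ γ ρ i j = (get ρ i ≤ᵇ j) ∧ (j <ᵇ get γ i)

hook : List ℕ → List ℕ → ℕ → ℕ → ℕ
hook γ ρ i j =
  length (filterᵇ (λ j' → (j ≤ᵇ j') ∧ inSkewᵇ γ ρ i j') (upTo (get γ i)))
  + length (filterᵇ (λ i' → (i <ᵇ i') ∧ inSkewᵇ γ ρ i' j) (upTo (length γ)))

hook₀ : List ℕ → ℕ → ℕ → ℕ
hook₀ γ = hook γ []

Good : ℕ → Skew → Set
Good k (γ , ρ) =
  (∀ i j → get ρ i ≤ j → j < get γ i → hook γ ρ i j ≤ k)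
  × (∀ i j → j < get ρ i → k < hook γ ρ i j)

-- Chain λs Ds : Ds = D_i ∷ D_{i+1} ∷ … ∷ D_r is the sequence built from
-- λs = (λ_i , … , λ_r): D_r = (λ_r)/∅ and D_i is obtained from D_{i+1}
-- by attaching a bottom row of length λ_i, i.e. γ̄ = (a+λ_i , γ…),
-- ρ̄ = (a , ρ…) for some a making γ̄ and ρ̄ partitions.
data Chain : List ℕ → List Skew → Set where
  base : ∀ l → Chain (l ∷ []) ((l ∷ [] , 0 ∷ []) ∷ [])
  step : ∀ {l ls γ ρ Ds} (a : ℕ) →
         Chain ls ((γ , ρ) ∷ Ds) →
         IsPartition ((a + l) ∷ γ) → IsPartition (a ∷ ρ) →
         Chain (l ∷ ls) (((a + l) ∷ γ , a ∷ ρ) ∷ (γ , ρ) ∷ Ds)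

KBoundedPartition : ℕ → List ℕ → Set
KBoundedPartition k lam = IsPartition lam × All (λ x → 1 ≤ x × x ≤ k) lam

IsCore : ℕ → List ℕ → Set
IsCore k γ = ∀ i j → j < get γ i → hook₀ γ i j ≢ suc k

IsRhoOf : ℕ → List ℕ → List ℕ → Set
IsRhoOf k γ ρ =
  ∀ i j → (j < get ρ i → j < get γ i × k < hook₀ γ i j)
        × (j < get γ i → k < hook₀ γ i j → j < get ρ i)

CharD1 : ℕ → List ℕ → Skew → Set
CharD1 k lam (γ , ρ) =
  IsPartition γ × IsPartition ρ
  × length γ ≡ length lam × length ρ ≡ length lam
  × (∀ j → j < length lam → get γ j ≡ get ρ j + get lam j)
  × IsCore k γ × IsRhoOf k γ ρ

{-# OPTIONS --safe #-}
-- The hook of γ/ρ at a cell (i, j) is γᵢ ∸ max(j, ρᵢ) plus the number of cells of γ/ρ above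
-- it in column j.  Attach a bottom row of length l at offset a ≥ ρ₁ to a diagram whose
-- columns have c(j) cells: the new hooks are l + c(j) for j < a and at most l + c(a) for
-- j ≥ a, as c is antitone right of ρ₁.  So conditions (1) and (2) on the new row say exactly
-- that a is the least j with l + c(j) ≤ k; it exists since c vanishes beyond γ₁, and a ≥ ρ₁
-- holds automatically because the old bottom row already has hooks l₀ + c(j) > k for j < ρ₁.
-- This builds the sequence and determines each Dᵢ from Dᵢ₊₁.
--
-- Outside ρ the hooks of γ/ρ and γ agree, and inside ρ the hook of γ is strictly larger, so
-- a good D₁ satisfies (b).  Conversely, under (a) and (b) the straight hook at (1, j) is
-- (ρ₁ ∸ j) + λ₁ + c(j), with c now counting cells of γ; it is ≤ k at j = ρ₁, and > k + 1 at
-- j = ρ₁ − 1 as γ is a (k+1)-core.  Hence ρ₁ is again the least j with λ₁ + c(j) ≤ k, and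
-- induction on the number of rows shows that D₁, and then the whole sequence, is unique.
module Submission where

open import Defs
open import Data.Nat using (ℕ; zero; suc; _+_; _∸_; _⊔_; _≤_; _<_; _≤ᵇ_; _<ᵇ_; z≤n; s≤s; z<s; s<s; s<s⁻¹; _≤?_; _<?_)
open import Data.Nat.Properties
open import Relation.Binary.Definitions using (tri<; tri≈; tri>)
open import Data.Bool using (Bool; true; false; _∧_; T)
open import Data.Bool.Properties using (∧-identityʳ; ∧-zeroʳ; T-∧)
open import Function.Bundles using (Equivalence)
open import Data.List using (List; []; _∷_; length; applyUpTo; filterᵇ)
open import Data.List.Relation.Unary.All as All using (All; []; _∷_)
open import Data.List.Relation.Unary.Linked as Linked using ([]; [-]; _∷_)
open import Data.Product using (Σ; ∃; ∃₂; _×_; _,_; proj₁; proj₂)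
open import Function using (id; _∘_)
open import Relation.Nullary using (¬_; yes; no; contradiction)
open import Relation.Nullary.Decidable using (dec-true; dec-false)
open import Relation.Unary using (Decidable)
open import Relation.Binary.PropositionalEquality

≤ᵇ-true : ∀ {m n} → m ≤ n → (m ≤ᵇ n) ≡ true
≤ᵇ-true = dec-true (_ ≤? _)

≤ᵇ-false : ∀ {m n} → ¬ m ≤ n → (m ≤ᵇ n) ≡ false
≤ᵇ-false = dec-false (_ ≤? _)

<ᵇ-true : ∀ {m n} → m < n → (m <ᵇ n) ≡ true
<ᵇ-true = dec-true (_ <? _)

<ᵇ-false : ∀ {m n} → ¬ m < n → (m <ᵇ n) ≡ false
<ᵇ-false = dec-false (_ <? _)

≤ᵇ-∧-≤ᵇ : ∀ m n t → ((m ≤ᵇ t) ∧ (n ≤ᵇ t)) ≡ (m ⊔ n ≤ᵇ t)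
≤ᵇ-∧-≤ᵇ m n t with m ⊔ n ≤? t
... | yes m⊔n≤t rewrite ≤ᵇ-true (m⊔n≤o⇒m≤o m n m⊔n≤t) | ≤ᵇ-true (m⊔n≤o⇒n≤o m n m⊔n≤t)
                      | ≤ᵇ-true m⊔n≤t = refl
... | no m⊔n≰t with m ≤? t
...   | no m≰t rewrite ≤ᵇ-false m≰t | ≤ᵇ-false m⊔n≰t = refl
...   | yes m≤t rewrite ≤ᵇ-true m≤t | ≤ᵇ-false (m⊔n≰t ∘ ⊔-lub m≤t) | ≤ᵇ-false m⊔n≰t = refl

indicator : Bool → ℕ
indicator true  = 1
indicator false = 0

count : (ℕ → Bool) → ℕ → ℕ
count p zero    = 0
count p (suc n) = indicator (p 0) + count (p ∘ suc) n

length-filterᵇ-applyUpTo : ∀ p (f : ℕ → ℕ) n → length (filterᵇ p (applyUpTo f n)) ≡ count (p ∘ f) n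
length-filterᵇ-applyUpTo p f zero = refl
length-filterᵇ-applyUpTo p f (suc n) with p (f 0)
... | true  = cong suc (length-filterᵇ-applyUpTo p (f ∘ suc) n)
... | false = length-filterᵇ-applyUpTo p (f ∘ suc) n

count-cong : ∀ {p q} n → (∀ t → t < n → p t ≡ q t) → count p n ≡ count q n
count-cong zero    _   = refl
count-cong (suc n) p≗q = cong₂ _+_ (cong indicator (p≗q 0 z<s)) (count-cong n (λ t → p≗q (suc t) ∘ s<s))

count-mono : ∀ {p q} n → (∀ t → t < n → T (p t) → T (q t)) → count p n ≤ count q n
count-mono         zero    _   = z≤n
count-mono {p} {q} (suc n) p⇒q =
  +-mono-≤ (indicator-mono (p 0) (q 0) (p⇒q 0 z<s)) (count-mono n (λ t → p⇒q (suc t) ∘ s<s))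
  where
  indicator-mono : ∀ a b → (T a → T b) → indicator a ≤ indicator b
  indicator-mono false _    _   = z≤n
  indicator-mono true  true _   = ≤-refl
  indicator-mono true  false a⇒b = contradiction _ a⇒b

count-none : ∀ {p} n → (∀ t → t < n → p t ≡ false) → count p n ≡ 0
count-none             zero    _    = refl
count-none {p} (suc n) none rewrite none 0 z<s = count-none n (λ t → none (suc t) ∘ s<s)

count-≤ᵇ : ∀ m n → count (m ≤ᵇ_) n ≡ n ∸ m
count-≤ᵇ zero    zero    = refl
count-≤ᵇ zero    (suc n) = cong suc (count-≤ᵇ zero n)
count-≤ᵇ (suc m) zero    = refl
count-≤ᵇ (suc m) (suc n) = trans (count-cong n (λ t _ → <ᵇ-suc m t)) (count-≤ᵇ m n)
  where
  <ᵇ-suc : ∀ m t → (m <ᵇ suc t) ≡ (m ≤ᵇ t)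
  <ᵇ-suc zero    t = refl
  <ᵇ-suc (suc m) t = refl

count-interval : ∀ j r g → count (λ t → (j ≤ᵇ t) ∧ ((r ≤ᵇ t) ∧ (t <ᵇ g))) g ≡ g ∸ (j ⊔ r)
count-interval j r g = trans (count-cong g inside) (count-≤ᵇ (j ⊔ r) g)
  where
  inside : ∀ t → t < g → ((j ≤ᵇ t) ∧ ((r ≤ᵇ t) ∧ (t <ᵇ g))) ≡ (j ⊔ r ≤ᵇ t)
  inside t t<g rewrite <ᵇ-true t<g | ∧-identityʳ (r ≤ᵇ t) = ≤ᵇ-∧-≤ᵇ j r t

cellsAbove : List ℕ → List ℕ → ℕ → ℕ → ℕ
cellsAbove γ ρ i j = count (λ t → (i <ᵇ t) ∧ inSkewᵇ γ ρ t j) (length γ)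

columnLength : List ℕ → List ℕ → ℕ → ℕ
columnLength γ ρ j = count (λ t → inSkewᵇ γ ρ t j) (length γ)

hook-split : ∀ γ ρ i j → hook γ ρ i j ≡ get γ i ∸ (j ⊔ get ρ i) + cellsAbove γ ρ i j
hook-split γ ρ i j =
  cong₂ _+_ (trans (length-filterᵇ-applyUpTo _ id (get γ i)) (count-interval j (get ρ i) (get γ i)))
            (length-filterᵇ-applyUpTo _ id (length γ))

hook-∷ : ∀ x y γ ρ i j → hook (x ∷ γ) (y ∷ ρ) (suc i) j ≡ hook γ ρ i j
hook-∷ x y γ ρ i j = trans (hook-split (x ∷ γ) (y ∷ ρ) (suc i) j) (sym (hook-split γ ρ i j))

hook₀-∷ : ∀ x γ i j → hook₀ (x ∷ γ) (suc i) j ≡ hook₀ γ i j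
hook₀-∷ x γ i j = trans (hook-split (x ∷ γ) [] (suc i) j) (sym (hook-split γ [] i j))

hook-bottom : ∀ g r γ ρ j → hook (g ∷ γ) (r ∷ ρ) 0 j ≡ g ∸ (j ⊔ r) + columnLength γ ρ j
hook-bottom g r γ ρ j = hook-split (g ∷ γ) (r ∷ ρ) 0 j

hook₀-bottom : ∀ g γ j → hook₀ (g ∷ γ) 0 j ≡ g ∸ j + columnLength γ [] j
hook₀-bottom g γ j =
  trans (hook-split (g ∷ γ) [] 0 j) (cong (λ m → g ∸ m + columnLength γ [] j) (⊔-identityʳ j))

hook-bottom-≤ : ∀ {g r l} γ ρ {j} → g ≡ r + l → j ≤ r → hook (g ∷ γ) (r ∷ ρ) 0 j ≡ l + columnLength γ ρ j
hook-bottom-≤ {g} {r} {l} γ ρ {j} g≡r+l j≤r =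
  trans (hook-bottom g r γ ρ j)
        (cong (_+ columnLength γ ρ j) (trans (cong₂ _∸_ g≡r+l (m≤n⇒m⊔n≡n j≤r)) (m+n∸m≡n r l)))

get-tail-≤-head : ∀ {x xs} → IsPartition (x ∷ xs) → get xs 0 ≤ x
get-tail-≤-head [-]       = z≤n
get-tail-≤-head (x≥y ∷ _) = x≥y

get-antitone : ∀ {xs i i'} → IsPartition xs → i ≤ i' → get xs i' ≤ get xs i
get-antitone {[]}                       _ _          = z≤n
get-antitone {_ ∷ _} {zero}  {zero}    _ _          = ≤-refl
get-antitone {_ ∷ _} {zero}  {suc _}   p _          =
  ≤-trans (get-antitone (Linked.tail p) z≤n) (get-tail-≤-head p)
get-antitone {_ ∷ _} {suc _} {suc _}   p (s≤s i≤i') = get-antitone (Linked.tail p) i≤i'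

get-beyond : ∀ xs {i} → length xs ≤ i → get xs i ≡ 0
get-beyond []       _         = refl
get-beyond (_ ∷ xs) (s≤s l≤i) = get-beyond xs l≤i

columnLength-antitone : ∀ γ {ρ} → IsPartition ρ → ∀ {j j'} → get ρ 0 ≤ j → j ≤ j' →
  columnLength γ ρ j' ≤ columnLength γ ρ j
columnLength-antitone γ {ρ} pρ {j} {j'} ρ₀≤j j≤j' = count-mono (length γ) cell
  where
  cell : ∀ t → t < length γ → T (inSkewᵇ γ ρ t j') → T (inSkewᵇ γ ρ t j)
  cell t _ in′ =
    Equivalence.from T-∧ (≤⇒≤ᵇ (≤-trans (get-antitone pρ z≤n) ρ₀≤j) , <⇒<ᵇ (≤-<-trans j≤j' j'<γₜ))
    where
    j'<γₜ : j' < get γ t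
    j'<γₜ = <ᵇ⇒< j' (get γ t) (proj₂ (Equivalence.to (T-∧ {get ρ t ≤ᵇ j'}) in′))

columnLength-beyond : ∀ {γ} ρ → IsPartition γ → ∀ {j} → get γ 0 ≤ j → columnLength γ ρ j ≡ 0
columnLength-beyond {γ} ρ pγ {j} γ₀≤j = count-none (length γ) empty
  where
  empty : ∀ t → t < length γ → inSkewᵇ γ ρ t j ≡ false
  empty t _ rewrite <ᵇ-false {j} {get γ t} (≤⇒≯ (≤-trans (get-antitone pγ z≤n) γ₀≤j)) = ∧-zeroʳ (get ρ t ≤ᵇ j)

columnLength-∷ : ∀ g r γ ρ {j} → j < r → columnLength (g ∷ γ) (r ∷ ρ) j ≡ columnLength γ ρ j
columnLength-∷ g r γ ρ j<r rewrite ≤ᵇ-false (<⇒≱ j<r) = refl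

SkewRows : List ℕ → List ℕ → List ℕ → Set
SkewRows lam γ ρ =
  IsPartition γ × IsPartition ρ × length γ ≡ length lam × length ρ ≡ length lam
  × (∀ j → j < length lam → get γ j ≡ get ρ j + get lam j)

skewRows-⊆ : ∀ {lam γ ρ} → SkewRows lam γ ρ → ∀ i → get ρ i ≤ get γ i
skewRows-⊆ {lam} {_} {ρ} (_ , _ , _ , ρ-length , rows) i with i <? length lam
... | yes i<ℓ rewrite rows i i<ℓ = m≤m+n (get ρ i) (get lam i)
... | no  i≮ℓ rewrite get-beyond ρ (subst (_≤ i) (sym ρ-length) (≮⇒≥ i≮ℓ)) = z≤n

hook₀≡hook : ∀ {γ ρ} → IsPartition ρ → ∀ {i j} → get ρ i ≤ j → hook₀ γ i j ≡ hook γ ρ i j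
hook₀≡hook {γ} {ρ} pρ {i} {j} ρᵢ≤j = begin
  hook γ [] i j                                 ≡⟨ hook-split γ [] i j ⟩
  get γ i ∸ (j ⊔ 0) + cellsAbove γ [] i j       ≡⟨ cong₂ (λ m c → get γ i ∸ m + c) arm above ⟩
  get γ i ∸ (j ⊔ get ρ i) + cellsAbove γ ρ i j  ≡⟨ sym (hook-split γ ρ i j) ⟩
  hook γ ρ i j                                  ∎
  where
  open ≡-Reasoning
  arm : j ⊔ 0 ≡ j ⊔ get ρ i
  arm = trans (⊔-identityʳ j) (sym (m≥n⇒m⊔n≡m ρᵢ≤j))
  above : cellsAbove γ [] i j ≡ cellsAbove γ ρ i j
  above = count-cong (length γ) cell
    where
    cell : ∀ t → t < length γ → ((i <ᵇ t) ∧ inSkewᵇ γ [] t j) ≡ ((i <ᵇ t) ∧ inSkewᵇ γ ρ t j)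
    cell t _ with i <? t
    ... | yes i<t rewrite <ᵇ-true i<t | ≤ᵇ-true (≤-trans (get-antitone pρ (<⇒≤ i<t)) ρᵢ≤j) = refl
    ... | no  i≮t rewrite <ᵇ-false i≮t = refl

hook<hook₀ : ∀ {γ ρ i j} → get ρ i ≤ get γ i → j < get ρ i → hook γ ρ i j < hook₀ γ i j
hook<hook₀ {γ} {ρ} {i} {j} ρᵢ≤γᵢ j<ρᵢ = begin-strict
  hook γ ρ i j                                  ≡⟨ hook-split γ ρ i j ⟩
  get γ i ∸ (j ⊔ get ρ i) + cellsAbove γ ρ i j  <⟨ +-mono-<-≤ arm (count-mono (length γ) above) ⟩
  get γ i ∸ (j ⊔ 0) + cellsAbove γ [] i j       ≡⟨ sym (hook-split γ [] i j) ⟩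
  hook₀ γ i j                                   ∎
  where
  open ≤-Reasoning
  arm : get γ i ∸ (j ⊔ get ρ i) < get γ i ∸ (j ⊔ 0)
  arm rewrite m≤n⇒m⊔n≡n (<⇒≤ j<ρᵢ) | ⊔-identityʳ j = ∸-monoʳ-< j<ρᵢ ρᵢ≤γᵢ
  above : ∀ t → t < length γ → T ((i <ᵇ t) ∧ inSkewᵇ γ ρ t j) → T ((i <ᵇ t) ∧ inSkewᵇ γ [] t j)
  above t _ with i <ᵇ t | get ρ t ≤ᵇ j
  ... | true | true = id

module _ {k γ ρ} (pρ : IsPartition ρ) (ρ⊆γ : ∀ i → get ρ i ≤ get γ i) (good : Good k (γ , ρ)) where

  good-hook₀-outside : ∀ i j → get ρ i ≤ j → j < get γ i → hook₀ γ i j ≤ k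
  good-hook₀-outside i j ρᵢ≤j j<γᵢ =
    subst (_≤ k) (sym (hook₀≡hook {γ} pρ ρᵢ≤j)) (proj₁ good i j ρᵢ≤j j<γᵢ)

  good-hook₀-inside : ∀ i j → j < get ρ i → suc k < hook₀ γ i j
  good-hook₀-inside i j j<ρᵢ = <-≤-trans (s≤s (proj₂ good i j j<ρᵢ)) (hook<hook₀ {γ} {ρ} (ρ⊆γ i) j<ρᵢ)

  good⇒core : IsCore k γ
  good⇒core i j j<γᵢ hook≡1+k with j <? get ρ i
  ... | yes j<ρᵢ = <-irrefl (sym hook≡1+k) (good-hook₀-inside i j j<ρᵢ)
  ... | no  j≮ρᵢ = <⇒≱ (≤-reflexive (sym hook≡1+k)) (good-hook₀-outside i j (≮⇒≥ j≮ρᵢ) j<γᵢ)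

  good⇒rhoOf : IsRhoOf k γ ρ
  good⇒rhoOf i j = inside , outside
    where
    inside : j < get ρ i → j < get γ i × k < hook₀ γ i j
    inside j<ρᵢ = <-≤-trans j<ρᵢ (ρ⊆γ i) , <-trans (n<1+n k) (good-hook₀-inside i j j<ρᵢ)
    outside : j < get γ i → k < hook₀ γ i j → j < get ρ i
    outside j<γᵢ k<hook = ≰⇒> (λ ρᵢ≤j → <⇒≱ k<hook (good-hook₀-outside i j ρᵢ≤j j<γᵢ))

good⇒charD1 : ∀ {k lam γ ρ} → SkewRows lam γ ρ → Good k (γ , ρ) → CharD1 k lam (γ , ρ)
good⇒charD1 {k} {lam} {γ} {ρ} rows@(pγ , pρ , γ-length , ρ-length , row-lengths) good =
  pγ , pρ , γ-length , ρ-length , row-lengths ,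
  good⇒core {k} {γ} pρ ρ⊆γ good , good⇒rhoOf {k} {γ} pρ ρ⊆γ good
  where
  ρ⊆γ : ∀ i → get ρ i ≤ get γ i
  ρ⊆γ = skewRows-⊆ {lam} rows

Least : (ℕ → Set) → ℕ → Set
Least P n = P n × (∀ m → m < n → ¬ P m)

least-unique : ∀ {P m n} → Least P m → Least P n → m ≡ n
least-unique {m = m} {n} (Pm , below-m) (Pn , below-n) with <-cmp m n
... | tri< m<n _ _ = contradiction Pm (below-n m m<n)
... | tri≈ _ m≡n _ = m≡n
... | tri> _ _ n<m = contradiction Pn (below-m n n<m)

least : ∀ {P} → Decidable P → ∀ {n} → P n → ∃ (Least P)
least P? Pn with P? 0
... | yes P0 = 0 , P0 , λ _ ()
least P? {zero}  P0   | no ¬P0 = contradiction P0 ¬P0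
least {P} P? {suc n} Pn | no ¬P0 with least {P ∘ suc} (P? ∘ suc) Pn
... | m , Psm , below = suc m , Psm , λ { zero _ → ¬P0 ; (suc m') (s≤s m'<m) → below m' m'<m }

charD1-tail : ∀ {k l lam g γ r ρ} → CharD1 k (l ∷ lam) (g ∷ γ , r ∷ ρ) → CharD1 k lam (γ , ρ)
charD1-tail {k} {g = g} {γ} (pγ , pρ , γ-length , ρ-length , rows , core , rhoOf) =
  Linked.tail pγ , Linked.tail pρ , suc-injective γ-length , suc-injective ρ-length ,
  (λ j → rows (suc j) ∘ s<s) ,
  (λ i j j<γᵢ → core (suc i) j j<γᵢ ∘ trans (hook₀-∷ g γ i j)) ,
  λ i j → let inside , outside = rhoOf (suc i) j in
    (λ j<ρᵢ → let j<γᵢ , k<hook = inside j<ρᵢ in j<γᵢ , subst (k <_) (hook₀-∷ g γ i j) k<hook) ,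
    (λ j<γᵢ → outside j<γᵢ ∘ subst (k <_) (sym (hook₀-∷ g γ i j)))

charD1-bottom-least : ∀ {k l lam g γ r ρ} → 1 ≤ l → CharD1 k (l ∷ lam) (g ∷ γ , r ∷ ρ) →
  Least (λ j → l + columnLength γ [] j ≤ k) r
charD1-bottom-least {k} {l} {_} {g} {γ} {r} 1≤l (_ , _ , _ , _ , rows , core , rhoOf) = at-r , below-r
  where
  g≡r+l : g ≡ r + l
  g≡r+l = rows 0 z<s
  hook-at : ∀ d {j} → j + d ≡ r → hook₀ (g ∷ γ) 0 j ≡ d + l + columnLength γ [] j
  hook-at d {j} j+d≡r = begin
    hook₀ (g ∷ γ) 0 j                      ≡⟨ hook₀-bottom g γ j ⟩
    g ∸ j + columnLength γ [] j            ≡⟨ cong (λ x → x ∸ j + columnLength γ [] j) g≡j+d+l ⟩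
    j + (d + l) ∸ j + columnLength γ [] j  ≡⟨ cong (_+ columnLength γ [] j) (m+n∸m≡n j (d + l)) ⟩
    d + l + columnLength γ [] j            ∎
    where
    open ≡-Reasoning
    g≡j+d+l : g ≡ j + (d + l)
    g≡j+d+l = trans g≡r+l (trans (cong (_+ l) (sym j+d≡r)) (+-assoc j d l))
  at-r : l + columnLength γ [] r ≤ k
  at-r = subst (_≤ k) (hook-at 0 (+-identityʳ r)) (≮⇒≥ (<-irrefl refl ∘ proj₂ (rhoOf 0 r) r<g))
    where
    r<g : r < g
    r<g = subst (r <_) (sym g≡r+l) (m<m+n r 1≤l)
  below-r : ∀ j → j < r → ¬ l + columnLength γ [] j ≤ k
  below-r j (s≤s {n = p} j≤p) =
    <⇒≱ (<-≤-trans k<at-p (+-monoʳ-≤ l (columnLength-antitone γ [] z≤n j≤p)))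
    where
    k<at-p : k < l + columnLength γ [] p
    k<at-p with p<g , k<hook ← proj₁ (rhoOf 0 p) (n<1+n p) =
      ≤-pred (subst (suc k <_) (hook-at 1 (+-comm p 1)) (≤∧≢⇒< k<hook (core 0 p p<g ∘ sym)))

charD1-unique : ∀ {k lam D D'} → All (1 ≤_) lam → CharD1 k lam D → CharD1 k lam D' → D ≡ D'
charD1-unique {D = [] , []}     {[] , []}       [] _ _ = refl
charD1-unique {D = _ ∷ _ , _}   {_}             [] (_ , _ , () , _) _
charD1-unique {D = [] , _ ∷ _}  {_}             [] (_ , _ , _ , () , _) _
charD1-unique {D = [] , []}     {_ ∷ _ , _}     [] _ (_ , _ , () , _)
charD1-unique {D = [] , []}     {[] , _ ∷ _}    [] _ (_ , _ , _ , () , _)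
charD1-unique {D = [] , _}      {_}             (_ ∷ _) (_ , _ , () , _) _
charD1-unique {D = _ ∷ _ , []}  {_}             (_ ∷ _) (_ , _ , _ , () , _) _
charD1-unique {D = _ ∷ _ , _ ∷ _} {[] , _}      (_ ∷ _) _ (_ , _ , () , _)
charD1-unique {D = _ ∷ _ , _ ∷ _} {_ ∷ _ , []}  (_ ∷ _) _ (_ , _ , _ , () , _)
charD1-unique {lam = l ∷ lam} {g ∷ γ , r ∷ ρ} {g' ∷ γ' , r' ∷ ρ'} (1≤l ∷ pos)
              c@(_ , _ , _ , _ , rows , _) c'@(_ , _ , _ , _ , rows' , _)
  with charD1-unique pos (charD1-tail c) (charD1-tail c')
... | refl = cong₂ (λ x y → x ∷ γ , y ∷ ρ) g≡g' r≡r'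
  where
  r≡r' : r ≡ r'
  r≡r' = least-unique (charD1-bottom-least 1≤l c) (charD1-bottom-least 1≤l c')
  g≡g' : g ≡ g'
  g≡g' = trans (rows 0 z<s) (trans (cong (_+ l) r≡r') (sym (rows' 0 z<s)))

good-∷ : ∀ {k x y γ ρ} → Good k (γ , ρ) →
  (∀ j → y ≤ j → j < x → hook (x ∷ γ) (y ∷ ρ) 0 j ≤ k) →
  (∀ j → j < y → k < hook (x ∷ γ) (y ∷ ρ) 0 j) →
  Good k (x ∷ γ , y ∷ ρ)
good-∷ {k} {x} {y} {γ} {ρ} (outside , inside) outside₀ inside₀ = outside′ , inside′
  where
  outside′ : ∀ i j → get (y ∷ ρ) i ≤ j → j < get (x ∷ γ) i → hook (x ∷ γ) (y ∷ ρ) i j ≤ k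
  outside′ zero    = outside₀
  outside′ (suc i) j ρᵢ≤j j<γᵢ = subst (_≤ k) (sym (hook-∷ x y γ ρ i j)) (outside i j ρᵢ≤j j<γᵢ)
  inside′ : ∀ i j → j < get (y ∷ ρ) i → k < hook (x ∷ γ) (y ∷ ρ) i j
  inside′ zero    = inside₀
  inside′ (suc i) j j<ρᵢ = subst (k <_) (sym (hook-∷ x y γ ρ i j)) (inside i j j<ρᵢ)

good-new-row : ∀ {k l a γ ρ} → IsPartition ρ → get ρ 0 ≤ a →
  Least (λ j → l + columnLength γ ρ j ≤ k) a → Good k (γ , ρ) → Good k (a + l ∷ γ , a ∷ ρ)
good-new-row {k} {l} {a} {γ} {ρ} pρ ρ₀≤a (at-a , below-a) good = good-∷ good outside₀ inside₀
  where
  outside₀ : ∀ j → a ≤ j → j < a + l → hook (a + l ∷ γ) (a ∷ ρ) 0 j ≤ k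
  outside₀ j a≤j _ = begin
    hook (a + l ∷ γ) (a ∷ ρ) 0 j          ≡⟨ hook-bottom (a + l) a γ ρ j ⟩
    a + l ∸ (j ⊔ a) + columnLength γ ρ j  ≡⟨ cong (λ m → a + l ∸ m + columnLength γ ρ j) (m≥n⇒m⊔n≡m a≤j) ⟩
    a + l ∸ j + columnLength γ ρ j        ≤⟨ +-mono-≤ (∸-monoʳ-≤ (a + l) a≤j) (columnLength-antitone γ pρ ρ₀≤a a≤j) ⟩
    a + l ∸ a + columnLength γ ρ a        ≡⟨ cong (_+ columnLength γ ρ a) (m+n∸m≡n a l) ⟩
    l + columnLength γ ρ a                ≤⟨ at-a ⟩
    k                                     ∎
    where open ≤-Reasoning
  inside₀ : ∀ j → j < a → k < hook (a + l ∷ γ) (a ∷ ρ) 0 j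
  inside₀ j j<a = subst (k <_) (sym (hook-bottom-≤ γ ρ refl (<⇒≤ j<a))) (≰⇒> (below-a j j<a))

good-single-row : ∀ {k l} → l ≤ k → Good k (l ∷ [] , 0 ∷ [])
good-single-row l≤k =
  good-new-row [] z≤n (subst (_≤ _) (sym (+-identityʳ _)) l≤k , λ _ ()) ((λ _ _ _ ()) , (λ _ _ ()))

good-extend : ∀ {k l l₀ lam γ ρ} → l₀ ≤ l → l ≤ k → SkewRows (l₀ ∷ lam) γ ρ → Good k (γ , ρ) →
  ∃ λ a → IsPartition (a + l ∷ γ) × IsPartition (a ∷ ρ) × Good k (a + l ∷ γ , a ∷ ρ)
good-extend {γ = []}         _ _ (_ , _ , () , _) _
good-extend {γ = _ ∷ _} {[]} _ _ (_ , _ , _ , () , _) _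
good-extend {k} {l} {l₀} {_} {g ∷ γ} {r ∷ ρ} l₀≤l l≤k (pγ , pρ , _ , _ , rows) good@(_ , inside) =
  a , g≤a+l ∷ pγ , r≤a ∷ pρ , good-new-row pρ r≤a (proj₂ least-offset) good
  where
  column : ℕ → ℕ
  column = columnLength (g ∷ γ) (r ∷ ρ)
  P : ℕ → Set
  P j = l + column j ≤ k
  g≡r+l₀ : g ≡ r + l₀
  g≡r+l₀ = rows 0 z<s
  Pg : P g
  Pg = subst (λ c → l + c ≤ k) (sym (columnLength-beyond (r ∷ ρ) pγ ≤-refl))
             (subst (_≤ k) (sym (+-identityʳ l)) l≤k)
  least-offset : ∃ (Least P)
  least-offset = least (λ j → l + column j ≤? k) Pg
  a : ℕ
  a = proj₁ least-offset
  ¬P-below-r : ∀ j → j < r → ¬ P j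
  ¬P-below-r j j<r = <⇒≱ (begin-strict
    k                         <⟨ inside 0 j j<r ⟩
    hook (g ∷ γ) (r ∷ ρ) 0 j  ≡⟨ hook-bottom-≤ γ ρ g≡r+l₀ (<⇒≤ j<r) ⟩
    l₀ + columnLength γ ρ j   ≡⟨ cong (l₀ +_) (sym (columnLength-∷ g r γ ρ j<r)) ⟩
    l₀ + column j             ≤⟨ +-monoˡ-≤ (column j) l₀≤l ⟩
    l + column j              ∎)
    where open ≤-Reasoning
  r≤a : r ≤ a
  r≤a = ≮⇒≥ (λ a<r → ¬P-below-r a a<r (proj₁ (proj₂ least-offset)))
  g≤a+l : g ≤ a + l
  g≤a+l = subst (_≤ a + l) (sym g≡r+l₀) (+-mono-≤ r≤a l₀≤l)

chain⇒skewRows : ∀ {lam γ ρ Ds} → Chain lam ((γ , ρ) ∷ Ds) → SkewRows lam γ ρ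
chain⇒skewRows (base l) = [-] , [-] , refl , refl , λ { zero _ → refl ; (suc _) (s≤s ()) }
chain⇒skewRows (step a chain pγ pρ) with _ , _ , γ-length , ρ-length , rows ← chain⇒skewRows chain =
  pγ , pρ , cong suc γ-length , cong suc ρ-length , λ { zero _ → refl ; (suc j) → rows j ∘ s<s⁻¹ }

good-chain-exists : ∀ {k l lam} → IsPartition (l ∷ lam) → All (_≤ k) (l ∷ lam) →
  ∃₂ λ D Ds → Chain (l ∷ lam) (D ∷ Ds) × All (Good k) (D ∷ Ds)
good-chain-exists {lam = []} _ (l≤k ∷ []) = _ , [] , base _ , good-single-row l≤k ∷ []
good-chain-exists {lam = _ ∷ _} (l≥l₀ ∷ dec) (l≤k ∷ bounds)
  with (γ , ρ) , Ds , chain , goods ← good-chain-exists dec bounds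
  with a , pγ , pρ , good ← good-extend l≥l₀ l≤k (chain⇒skewRows chain) (All.head goods) =
  _ , _ , step a chain pγ pρ , good ∷ goods

good-chain-unique : ∀ {k lam Es Fs} → All (1 ≤_) lam →
  Chain lam Es → All (Good k) Es → Chain lam Fs → All (Good k) Fs → Es ≡ Fs
good-chain-unique _ (base l) _ (base .l) _ = refl
good-chain-unique (1≤l ∷ pos) E@(step _ chain _ _) (good ∷ goods) F@(step _ chain′ _ _) (good′ ∷ goods′) =
  cong₂ _∷_ (charD1-unique (1≤l ∷ pos) (good⇒charD1 (chain⇒skewRows E) good)
                                       (good⇒charD1 (chain⇒skewRows F) good′))
            (good-chain-unique pos chain goods chain′ goods′)

lemma5 : (k : ℕ) → 1 ≤ k → (lam : List ℕ) → lam ≢ [] → KBoundedPartition k lam →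
    Σ Skew λ D₁ → Σ (List Skew) λ Ds →
      (Chain lam (D₁ ∷ Ds) × All (Good k) (D₁ ∷ Ds)
        × (∀ Es → Chain lam Es → All (Good k) Es → Es ≡ D₁ ∷ Ds))
      × (CharD1 k lam D₁ × (∀ E → CharD1 k lam E → E ≡ D₁))
lemma5 k _ []          nonempty _                    = contradiction refl nonempty
lemma5 k _ lam@(_ ∷ _) _        (decreasing , parts)
  with (γ , ρ) , Ds , chain , goods ← good-chain-exists decreasing (All.map proj₂ parts) =
  (γ , ρ) , Ds ,
  (chain , goods , λ Es chainE goodsE → good-chain-unique positive chainE goodsE chain goods) ,
  (charD₁ , λ E charE → charD1-unique positive charE charD₁)
  where
  positive : All (1 ≤_) lam
  positive = All.map proj₁ parts
  charD₁ : CharD1 k lam (γ , ρ)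
  charD₁ = good⇒charD1 (chain⇒skewRows chain) (All.head goods)
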